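{- For every integer $k \geq 4$, let $G$ be the tree constructed as follows. Take a vertex $v_0$ adjacent to three vertices $v_1, v_2, v_3$ (and to no other vertices). Attach to $v_1$ one pendant path with four vertices (new vertices $a_1,a_2,a_3,a_4$ with edges $v_1a_1, a_1a_2, a_2a_3, a_3a_4$) and two pendant paths with two vertices each; attach to $v_2$ exactly $k$ pendant paths with two vertices each, and to $v_3$ exactly $k$ pendant paths with two vertices each. Here attaching a pendant path $a b$ (a copy of $K_2$) to $v_i$ means adding new vertices $a, b$ and edges $v_i a$ and $a b$. Then the independence polynomial of $G$ is not log-concave.
   Context: An independent set in a graph is a set of pairwise non-adjacent vertices; $\alpha(G)$ denotes the maximum size of an independent set. The independence polynomial of $G$ is $I(G;x)=\sum_{k=0}^{\alpha(G)} s_k x^k$, where $s_k$ is the number of independent sets of size $k$ in $G$. A polynomial $\sum_{k=0}^{n} a_k x^k$ is called log-concave if its coefficient sequence satisfies $a_k^2 \geq a_{k-1}a_{k+1}$ for all $k\in\{1,\dots,n-1\}$. -}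

module Defs where

open import Data.Nat using (ℕ; zero; suc; _+_; _*_; _≤_; _<_; _⊔_; _≟_)
open import Data.Nat.Properties using () renaming (_≟_ to _≟ℕ_)
open import Data.Fin using (Fin; toℕ)
open import Data.Fin.Subset using (Subset; _∈_; ∣_∣; inside; outside)
open import Data.Fin.Subset.Properties using (_∈?_)
open import Data.Fin.Properties using (all?)
open import Data.Vec using (_∷_; [])
open import Data.List using (List; []; _∷_; _++_; map; filter; length; foldr; concatMap; upTo)
open import Data.Product using (_×_; _,_)
open import Data.Product.Properties using (≡-dec)
open import Data.Sum using (_⊎_)
open import Relation.Nullary using (¬_; Dec)
open import Relation.Nullary.Decidable using (_×-dec_; _→-dec_; _⊎-dec_; ¬?)
open import Relation.Binary.PropositionalEquality using (_≡_)
import Data.List.Membership.DecPropositional as DecMem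

record Graph : Set₁ where
  field
    n    : ℕ
    Adj  : Fin n → Fin n → Set
    adj? : (u v : Fin n) → Dec (Adj u v)

open Graph public

Independent : (G : Graph) → Subset (n G) → Set
Independent G S = ∀ u v → u ∈ S → v ∈ S → ¬ Adj G u v

independent? : (G : Graph) (S : Subset (n G)) → Dec (Independent G S)
independent? G S =
  all? λ u → all? λ v → (u ∈? S) →-dec ((v ∈? S) →-dec ¬? (adj? G u v))

allSubsets : (m : ℕ) → List (Subset m)
allSubsets zero    = [] ∷ []
allSubsets (suc m) = map (outside ∷_) (allSubsets m) ++ map (inside ∷_) (allSubsets m)

independentSets : (G : Graph) → List (Subset (n G))
independentSets G = filter (independent? G) (allSubsets (n G))

indepCount : (G : Graph) → ℕ → ℕ
indepCount G j = length (filter (λ S → ∣ S ∣ ≟ j) (independentSets G))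

α : Graph → ℕ
α G = foldr _⊔_ 0 (map ∣_∣ (independentSets G))

LogConcave : (a : ℕ → ℕ) (d : ℕ) → Set
LogConcave a d = ∀ k → 1 ≤ suc k → suc k < d →
  a k * a (suc (suc k)) ≤ a (suc k) * a (suc k)

IndepPolyLogConcave : Graph → Set
IndepPolyLogConcave G = LogConcave (indepCount G) (α G)

-- It has 12 + 4k vertices,
-- numbered as follows:
--   v0 = 0, v1 = 1, v2 = 2, v3 = 3,
--   the pendant P4 at v1:   a1 = 4, a2 = 5, a3 = 6, a4 = 7
--   the two pendant K2's at v1:   (8, 9), (10, 11)
--   the k pendant K2's at v2:  (12 + 2i, 13 + 2i)            for i < k
--   the k pendant K2's at v3:  (12 + 2k + 2i, 13 + 2k + 2i)  for i < k
-- where a pendant K2 (a, b) at v means edges v–a and a–b.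

pendantK2 : ℕ → ℕ → List (ℕ × ℕ)
pendantK2 v a = (v , a) ∷ (a , suc a) ∷ []

treeEdges : ℕ → List (ℕ × ℕ)
treeEdges k =
  (0 , 1) ∷ (0 , 2) ∷ (0 , 3) ∷
  (1 , 4) ∷ (4 , 5) ∷ (5 , 6) ∷ (6 , 7) ∷
  pendantK2 1 8 ++ pendantK2 1 10 ++
  concatMap (λ i → pendantK2 2 (12 + 2 * i)) (upTo k) ++
  concatMap (λ i → pendantK2 3 (12 + 2 * k + 2 * i)) (upTo k)

open DecMem (≡-dec _≟ℕ_ _≟ℕ_) using () renaming (_∈_ to _∈ₑ_; _∈?_ to _∈ₑ?_)

treeAdj : (k : ℕ) → Fin (12 + 4 * k) → Fin (12 + 4 * k) → Set
treeAdj k u v = ((toℕ u , toℕ v) ∈ₑ treeEdges k) ⊎ ((toℕ v , toℕ u) ∈ₑ treeEdges k)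

tree : ℕ → Graph
tree k = record
  { n    = 12 + 4 * k
  ; Adj  = treeAdj k
  ; adj? = λ u v → ((toℕ u , toℕ v) ∈ₑ? treeEdges k) ⊎-dec ((toℕ v , toℕ u) ∈ₑ? treeEdges k)
  }

module Submission where

-- An independent set of the tree is an independent set c of the twelve core vertices
-- (v₀, …, v₃, the path a₁a₂a₃a₄ and the two K₂'s at v₁) together with at most one
-- vertex from each of the 2k pendant K₂'s at v₂ and v₃, where the vertex adjacent to
-- the hub is excluded whenever the hub lies in c.  The pendant part therefore has at
-- most 2k vertices, and the top coefficients s_{2k+5}, s_{2k+6}, s_{2k+7} only see core
-- sets with at least five vertices.  Enumerating those gives
--   s_{2k+5} ≥ 13·4^k,   s_{2k+7} ≥ 1,   s_{2k+6} ≤ 17 + 2·2^k + 2k,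
-- and for k ≥ 4 the square of the middle bound is below 13·4^k.

open import Defs
open import Algebra.Properties.CommutativeSemigroup using (interchange)
open import Data.Bool using (Bool; true; false; T; T?; not; _∧_; _∨_; _xor_; if_then_else_)
open import Data.Bool.ListAction using (all)
open import Data.Bool.Properties using (∧-assoc; T-∧)
open import Data.Empty using (⊥; ⊥-elim)
open import Data.Fin using (zero; suc; toℕ)
open import Data.Fin.Subset using (Subset; _∈_; ∣_∣; inside; outside)
open import Data.Fin.Subset.Properties using (anySubset?)
open import Data.List using (List; []; _∷_; filter; length; map; foldr; concatMap; upTo; applyUpTo)
  renaming (_++_ to _++ₗ_)
open import Data.List.Membership.Propositional using () renaming (_∈_ to _∈ₗ_)
open import Data.List.Properties using (map-++; map-∘; map-upTo; concatMap-map; concatMap-cong)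
import Data.List.Relation.Unary.All as All
open import Data.List.Relation.Unary.All.Properties using (all⁺; all⁻)
open import Data.Nat using (ℕ; zero; suc; _+_; _*_; _^_; _≤_; _<_; _≡ᵇ_; _⊔_; z≤n; s≤s; _≤?_)
open import Data.Nat.ListAction using (sum)
open import Data.Nat.ListAction.Properties using (sum-++)
open import Data.Nat.Properties
open import Data.Nat.Tactic.RingSolver using (solve-∀)
open import Data.Product using (_×_; _,_; proj₂; ∃)
open import Data.Sum using (_⊎_; inj₁; inj₂)
open import Data.Vec using ([]; _∷_; _++_; here; there)
open import Function using (_∘_)
open import Function.Bundles using (_⇔_; mk⇔; Equivalence)
open import Relation.Binary.PropositionalEquality
open import Relation.Nullary using (¬_; Dec; does; yes; no)
open import Relation.Nullary.Decidable
  using (does-⇔; decidable-stable; toWitnessFalse; _×-dec_; _⊎-dec_; ¬?)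
open import Relation.Unary using (Pred; Decidable)

𝟙 : Bool → ℕ
𝟙 b = if b then 1 else 0

𝟙-mono-≤ : ∀ {a b} → (T a → T b) → 𝟙 a ≤ 𝟙 b
𝟙-mono-≤ {false}         _   = z≤n
𝟙-mono-≤ {true} {true}  _   = ≤-refl
𝟙-mono-≤ {true} {false} a⇒b = ⊥-elim (a⇒b _)

𝟙-cong : ∀ {a b} → (T a → T b) → (T b → T a) → 𝟙 a ≡ 𝟙 b
𝟙-cong a⇒b b⇒a = ≤-antisym (𝟙-mono-≤ a⇒b) (𝟙-mono-≤ b⇒a)

𝟙-false : ∀ {b} → ¬ T b → 𝟙 b ≡ 0
𝟙-false {false} _  = refl
𝟙-false {true}  ¬b = ⊥-elim (¬b _)

𝟙-∧ : ∀ a b → 𝟙 (a ∧ b) ≡ 𝟙 a * 𝟙 b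
𝟙-∧ false b = refl
𝟙-∧ true  b = sym (+-identityʳ (𝟙 b))

𝟙-≤-+ : ∀ {a b c} → (T a → T b ⊎ T c) → 𝟙 a ≤ 𝟙 b + 𝟙 c
𝟙-≤-+ {false} _ = z≤n
𝟙-≤-+ {true} {b} {c} a⇒b∨c with a⇒b∨c _
... | inj₁ Tb = ≤-trans (𝟙-mono-≤ {true} {b} (λ _ → Tb)) (m≤m+n (𝟙 b) (𝟙 c))
... | inj₂ Tc = ≤-trans (𝟙-mono-≤ {true} {c} (λ _ → Tc)) (m≤n+m (𝟙 c) (𝟙 b))

𝟙-*-≤ : ∀ {b x y} → (T b → x ≤ y) → 𝟙 b * x ≤ y
𝟙-*-≤ {false}     _   = z≤n
𝟙-*-≤ {true} {x} x≤y = ≤-trans (≤-reflexive (+-identityʳ x)) (x≤y _)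

if-∧ : ∀ a b {x : ℕ} → (if a ∧ b then x else 0) ≡ (if a then (if b then x else 0) else 0)
if-∧ false b = refl
if-∧ true  b = refl

hasSize : ℕ → ℕ → ℕ
hasSize p s = 𝟙 (s ≡ᵇ p)

s+[k+k]≡2k+s : ∀ k s → s + (k + k) ≡ 2 * k + s
s+[k+k]≡2k+s = solve-∀

m+n≡o+o⇒m≡o×n≡o : ∀ {m n o} → m ≤ o → n ≤ o → m + n ≡ o + o → m ≡ o × n ≡ o
m+n≡o+o⇒m≡o×n≡o {m} {n} {o} m≤o n≤o m+n≡o+o =
  m≡o , +-cancelˡ-≡ o n o (subst (λ x → x + n ≡ o + o) m≡o m+n≡o+o)
  where
  o≤m : o ≤ m
  o≤m = +-cancelʳ-≤ o o m (≤-trans (≤-reflexive (sym m+n≡o+o)) (+-monoʳ-≤ m n≤o))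
  m≡o : m ≡ o
  m≡o = ≤-antisym m≤o o≤m

1+m+n≡o+o⇒m≡o⊎n≡o : ∀ {m n o} → m ≤ o → n ≤ o → suc (m + n) ≡ o + o →
  (m ≡ o × suc n ≡ o) ⊎ (suc m ≡ o × n ≡ o)
1+m+n≡o+o⇒m≡o⊎n≡o {m} {n} {o} m≤o n≤o eq with m ≟ o
... | yes refl = inj₁ (refl , +-cancelˡ-≡ m (suc n) m (trans (+-suc m n) eq))
... | no m≢o   = inj₂ (m+n≡o+o⇒m≡o×n≡o (≤∧≢⇒< m≤o m≢o) n≤o eq)

module _ {s j k p q : ℕ} (p≤k : p ≤ k) (q≤k : q ≤ k) where

  hasSize-beyond : s + (k + k) < j → hasSize j (s + (p + q)) ≡ 0
  hasSize-beyond s+2k<j = 𝟙-false λ eq →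
    <⇒≢ (≤-<-trans (+-monoʳ-≤ s (+-mono-≤ p≤k q≤k)) s+2k<j) (≡ᵇ⇒≡ _ _ eq)

  hasSize-maximum : s + (k + k) ≡ j → hasSize j (s + (p + q)) ≡ hasSize k p * hasSize k q
  hasSize-maximum s+2k≡j = trans (𝟙-cong to from) (𝟙-∧ (p ≡ᵇ k) (q ≡ᵇ k))
    where
    to : T (s + (p + q) ≡ᵇ j) → T ((p ≡ᵇ k) ∧ (q ≡ᵇ k))
    to eq with p≡k , q≡k ← m+n≡o+o⇒m≡o×n≡o p≤k q≤k (+-cancelˡ-≡ s _ _ (trans (≡ᵇ⇒≡ _ _ eq) (sym s+2k≡j))) =
      Equivalence.from T-∧ (≡⇒≡ᵇ p k p≡k , ≡⇒≡ᵇ q k q≡k)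
    from : T ((p ≡ᵇ k) ∧ (q ≡ᵇ k)) → T (s + (p + q) ≡ᵇ j)
    from pq with p≡k , q≡k ← Equivalence.to T-∧ pq =
      ≡⇒≡ᵇ _ _ (trans (cong₂ (λ a b → s + (a + b)) (≡ᵇ⇒≡ p k p≡k) (≡ᵇ⇒≡ q k q≡k)) s+2k≡j)

module _ {s j m p q : ℕ} (p≤1+m : p ≤ suc m) (q≤1+m : q ≤ suc m) where

  hasSize-submaximum : s + (suc m + suc m) ≡ suc j →
    hasSize j (s + (p + q)) ≤ hasSize (suc m) p * hasSize m q + hasSize m p * hasSize (suc m) q
  hasSize-submaximum s+2k≡1+j =
    ≤-trans (𝟙-≤-+ to) (≤-reflexive (cong₂ _+_ (𝟙-∧ (p ≡ᵇ suc m) (q ≡ᵇ m)) (𝟙-∧ (p ≡ᵇ m) (q ≡ᵇ suc m))))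
    where
    to : T (s + (p + q) ≡ᵇ j) → T ((p ≡ᵇ suc m) ∧ (q ≡ᵇ m)) ⊎ T ((p ≡ᵇ m) ∧ (q ≡ᵇ suc m))
    to eq with 1+m+n≡o+o⇒m≡o⊎n≡o p≤1+m q≤1+m
                 (+-cancelˡ-≡ s _ _ (trans (+-suc s (p + q)) (trans (cong suc (≡ᵇ⇒≡ _ _ eq)) (sym s+2k≡1+j))))
    ... | inj₁ (p≡k , 1+q≡k) = inj₁ (Equivalence.from T-∧ (≡⇒≡ᵇ _ _ p≡k , ≡⇒≡ᵇ _ _ (suc-injective 1+q≡k)))
    ... | inj₂ (1+p≡k , q≡k) = inj₂ (Equivalence.from T-∧ (≡⇒≡ᵇ _ _ (suc-injective 1+p≡k) , ≡⇒≡ᵇ _ _ q≡k))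

-- Opaque so that sums over the 2¹² core sets are unfolded only where they are computed
-- (coreCount-…), never while checking conversions between equal summands.
opaque
  sumSubsets : ∀ n → (Subset n → ℕ) → ℕ
  sumSubsets zero    f = f []
  sumSubsets (suc n) f = sumSubsets n (f ∘ (outside ∷_)) + sumSubsets n (f ∘ (inside ∷_))

  sumSubsets-[] : (f : Subset 0 → ℕ) → sumSubsets 0 f ≡ f []
  sumSubsets-[] f = refl

  sumSubsets-suc-suc : ∀ n (f : Subset (2 + n) → ℕ) →
    sumSubsets (2 + n) f ≡
    (sumSubsets n (λ S → f (false ∷ false ∷ S)) + sumSubsets n (λ S → f (false ∷ true ∷ S))) +
    (sumSubsets n (λ S → f (true ∷ false ∷ S)) + sumSubsets n (λ S → f (true ∷ true ∷ S)))
  sumSubsets-suc-suc n f = refl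

  sum-map-allSubsets : ∀ n (f : Subset n → ℕ) → sum (map f (allSubsets n)) ≡ sumSubsets n f
  sum-map-allSubsets zero    f = +-identityʳ (f [])
  sum-map-allSubsets (suc n) f = begin
    sum (map f (map (outside ∷_) Ss ++ₗ map (inside ∷_) Ss))
      ≡⟨ cong sum (map-++ f (map (outside ∷_) Ss) _) ⟩
    sum (map f (map (outside ∷_) Ss) ++ₗ map f (map (inside ∷_) Ss))
      ≡⟨ sum-++ (map f (map (outside ∷_) Ss)) _ ⟩
    sum (map f (map (outside ∷_) Ss)) + sum (map f (map (inside ∷_) Ss))
      ≡⟨ cong₂ (λ xs ys → sum xs + sum ys) (sym (map-∘ Ss)) (sym (map-∘ Ss)) ⟩
    sum (map (f ∘ (outside ∷_)) Ss) + sum (map (f ∘ (inside ∷_)) Ss)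
      ≡⟨ cong₂ _+_ (sum-map-allSubsets n _) (sum-map-allSubsets n _) ⟩
    sumSubsets (suc n) f ∎
    where
    open ≡-Reasoning
    Ss : List (Subset n)
    Ss = allSubsets n

  sumSubsets-cong : ∀ n {f g : Subset n → ℕ} → (∀ S → f S ≡ g S) → sumSubsets n f ≡ sumSubsets n g
  sumSubsets-cong zero    f≗g = f≗g []
  sumSubsets-cong (suc n) f≗g =
    cong₂ _+_ (sumSubsets-cong n (f≗g ∘ (outside ∷_))) (sumSubsets-cong n (f≗g ∘ (inside ∷_)))

  sumSubsets-mono-≤ : ∀ n {f g : Subset n → ℕ} → (∀ S → f S ≤ g S) → sumSubsets n f ≤ sumSubsets n g
  sumSubsets-mono-≤ zero    f≤g = f≤g []
  sumSubsets-mono-≤ (suc n) f≤g =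
    +-mono-≤ (sumSubsets-mono-≤ n (f≤g ∘ (outside ∷_))) (sumSubsets-mono-≤ n (f≤g ∘ (inside ∷_)))

  sumSubsets-zero : ∀ n {f : Subset n → ℕ} → (∀ S → f S ≡ 0) → sumSubsets n f ≡ 0
  sumSubsets-zero zero    f≗0 = f≗0 []
  sumSubsets-zero (suc n) f≗0 =
    cong₂ _+_ (sumSubsets-zero n (f≗0 ∘ (outside ∷_))) (sumSubsets-zero n (f≗0 ∘ (inside ∷_)))

  sumSubsets-distrib-+ : ∀ n (f g : Subset n → ℕ) →
    sumSubsets n (λ S → f S + g S) ≡ sumSubsets n f + sumSubsets n g
  sumSubsets-distrib-+ zero    f g = refl
  sumSubsets-distrib-+ (suc n) f g = begin
    sumSubsets n (λ S → f (outside ∷ S) + g (outside ∷ S)) +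
    sumSubsets n (λ S → f (inside ∷ S) + g (inside ∷ S))
      ≡⟨ cong₂ _+_ (sumSubsets-distrib-+ n _ _) (sumSubsets-distrib-+ n _ _) ⟩
    (sumSubsets n (f ∘ (outside ∷_)) + sumSubsets n (g ∘ (outside ∷_))) +
    (sumSubsets n (f ∘ (inside ∷_)) + sumSubsets n (g ∘ (inside ∷_)))
      ≡⟨ interchange +-commutativeSemigroup
           (sumSubsets n (f ∘ (outside ∷_))) _ (sumSubsets n (f ∘ (inside ∷_))) _ ⟩
    sumSubsets (suc n) f + sumSubsets (suc n) g ∎
    where open ≡-Reasoning

  *-distribˡ-sumSubsets : ∀ n a (f : Subset n → ℕ) → a * sumSubsets n f ≡ sumSubsets n (λ S → a * f S)
  *-distribˡ-sumSubsets zero    a f = refl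
  *-distribˡ-sumSubsets (suc n) a f = begin
    a * (sumSubsets n (f ∘ (outside ∷_)) + sumSubsets n (f ∘ (inside ∷_)))
      ≡⟨ *-distribˡ-+ a _ _ ⟩
    a * sumSubsets n (f ∘ (outside ∷_)) + a * sumSubsets n (f ∘ (inside ∷_))
      ≡⟨ cong₂ _+_ (*-distribˡ-sumSubsets n a _) (*-distribˡ-sumSubsets n a _) ⟩
    sumSubsets (suc n) (λ S → a * f S) ∎
    where open ≡-Reasoning

  sumSubsets-++ : ∀ m n (f : Subset (m + n) → ℕ) →
    sumSubsets (m + n) f ≡ sumSubsets m (λ u → sumSubsets n (λ v → f (u ++ v)))
  sumSubsets-++ zero    n f = refl
  sumSubsets-++ (suc m) n f =
    cong₂ _+_ (sumSubsets-++ m n (f ∘ (outside ∷_))) (sumSubsets-++ m n (f ∘ (inside ∷_)))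

  sumSubsets-subst : ∀ {m n} (m≡n : m ≡ n) (f : Subset n → ℕ) →
    sumSubsets n f ≡ sumSubsets m (f ∘ subst Subset m≡n)
  sumSubsets-subst refl f = refl

sumSubsets-if : ∀ n b (f : Subset n → ℕ) →
  sumSubsets n (λ S → if b then f S else 0) ≡ (if b then sumSubsets n f else 0)
sumSubsets-if n false f = sumSubsets-zero n λ _ → refl
sumSubsets-if n true  f = refl

sumWhere : ∀ n → (Subset n → Bool) → (Subset n → ℕ) → ℕ
sumWhere n P f = sumSubsets n (λ S → if P S then f S else 0)

module _ (n : ℕ) (P : Subset n → Bool) where

  sumWhere-cong : {f g : Subset n → ℕ} → (∀ S → T (P S) → f S ≡ g S) → sumWhere n P f ≡ sumWhere n P g
  sumWhere-cong f≗g = sumSubsets-cong n λ S → guarded (P S) (f≗g S)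
    where
    guarded : ∀ b {x y} → (T b → x ≡ y) → (if b then x else 0) ≡ (if b then y else 0)
    guarded false _   = refl
    guarded true  x≡y = x≡y _

  sumWhere-mono-≤ : {f g : Subset n → ℕ} → (∀ S → T (P S) → f S ≤ g S) → sumWhere n P f ≤ sumWhere n P g
  sumWhere-mono-≤ f≤g = sumSubsets-mono-≤ n λ S → guarded (P S) (f≤g S)
    where
    guarded : ∀ b {x y} → (T b → x ≤ y) → (if b then x else 0) ≤ (if b then y else 0)
    guarded false _   = z≤n
    guarded true  x≤y = x≤y _

  sumWhere-zero : {f : Subset n → ℕ} → (∀ S → T (P S) → f S ≡ 0) → sumWhere n P f ≡ 0
  sumWhere-zero f≗0 = sumSubsets-zero n λ S → guarded (P S) (f≗0 S)
    where
    guarded : ∀ b {x} → (T b → x ≡ 0) → (if b then x else 0) ≡ 0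
    guarded false _   = refl
    guarded true  x≡0 = x≡0 _

  sumWhere-distrib-+ : (f g : Subset n → ℕ) →
    sumWhere n P (λ S → f S + g S) ≡ sumWhere n P f + sumWhere n P g
  sumWhere-distrib-+ f g =
    trans (sumSubsets-cong n λ S → guarded (P S)) (sumSubsets-distrib-+ n _ _)
    where
    guarded : ∀ b {x y} → (if b then x + y else 0) ≡ (if b then x else 0) + (if b then y else 0)
    guarded false = refl
    guarded true  = refl

  *-distribˡ-sumWhere : ∀ a (f : Subset n → ℕ) → a * sumWhere n P f ≡ sumWhere n P (λ S → a * f S)
  *-distribˡ-sumWhere a f =
    trans (*-distribˡ-sumSubsets n a _) (sumSubsets-cong n λ S → guarded (P S))
    where
    guarded : ∀ b {x} → a * (if b then x else 0) ≡ (if b then a * x else 0)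
    guarded false = *-zeroʳ a
    guarded true  = refl

  *-distribʳ-sumWhere : ∀ a (f : Subset n → ℕ) → sumWhere n P f * a ≡ sumWhere n P (λ S → f S * a)
  *-distribʳ-sumWhere a f = begin
    sumWhere n P f * a             ≡⟨ *-comm _ a ⟩
    a * sumWhere n P f             ≡⟨ *-distribˡ-sumWhere a f ⟩
    sumWhere n P (λ S → a * f S)   ≡⟨ sumWhere-cong (λ S _ → *-comm a (f S)) ⟩
    sumWhere n P (λ S → f S * a)   ∎
    where open ≡-Reasoning

sumWhere-product : ∀ m n (P : Subset m → Bool) (Q : Subset n → Bool)
  (f : Subset m → ℕ) (g : Subset n → ℕ) →
  sumWhere m P (λ u → sumWhere n Q (λ v → f u * g v)) ≡ sumWhere m P f * sumWhere n Q g
sumWhere-product m n P Q f g = begin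
  sumWhere m P (λ u → sumWhere n Q (λ v → f u * g v))
    ≡⟨ sumWhere-cong m P (λ u _ → sym (*-distribˡ-sumWhere n Q (f u) g)) ⟩
  sumWhere m P (λ u → f u * sumWhere n Q g)
    ≡⟨ sym (*-distribʳ-sumWhere m P (sumWhere n Q g) f) ⟩
  sumWhere m P f * sumWhere n Q g ∎
  where open ≡-Reasoning

length-filter-filter : ∀ {a p q} {A : Set a} {P : Pred A p} {Q : Pred A q}
  (P? : Decidable P) (Q? : Decidable Q) xs →
  length (filter P? (filter Q? xs)) ≡ sum (map (λ x → if does (Q? x) then 𝟙 (does (P? x)) else 0) xs)
length-filter-filter P? Q? [] = refl
length-filter-filter P? Q? (x ∷ xs) with does (Q? x)
... | false = length-filter-filter P? Q? xs
... | true with does (P? x)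
...   | false = length-filter-filter P? Q? xs
...   | true  = cong suc (length-filter-filter P? Q? xs)

indepCount-sumWhere : ∀ G j →
  indepCount G j ≡ sumWhere (n G) (does ∘ independent? G) (hasSize j ∘ ∣_∣)
indepCount-sumWhere G j =
  trans (length-filter-filter _ (independent? G) (allSubsets (n G))) (sum-map-allSubsets (n G) _)

≤-foldr-⊔ : ∀ {a} {A : Set a} (f : A → ℕ) j xs →
  1 ≤ length (filter (λ x → f x ≟ j) xs) → j ≤ foldr _⊔_ 0 (map f xs)
≤-foldr-⊔ f j (x ∷ xs) nonempty with f x ≡ᵇ j in fx≡ᵇj
... | true  = ≤-trans (≤-reflexive (sym (≡ᵇ⇒≡ (f x) j (subst T (sym fx≡ᵇj) _)))) (m≤m⊔n (f x) _)
... | false = ≤-trans (≤-foldr-⊔ f j xs nonempty) (m≤n⊔m (f x) _)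

≤-α : ∀ G j → 1 ≤ indepCount G j → j ≤ α G
≤-α G j = ≤-foldr-⊔ ∣_∣ j (independentSets G)

isIn : ∀ {n} → Subset n → ℕ → Bool
isIn []      _       = false
isIn (x ∷ S) zero    = x
isIn (x ∷ S) (suc i) = isIn S i

∈⇒isIn : ∀ {n} {S : Subset n} {u} → u ∈ S → T (isIn S (toℕ u))
∈⇒isIn here        = _
∈⇒isIn (there u∈S) = ∈⇒isIn u∈S

isIn⇒∈ : ∀ {n} (S : Subset n) i → T (isIn S i) → ∃ λ u → toℕ u ≡ i × u ∈ S
isIn⇒∈ (true ∷ S) zero    _ = zero , refl , here
isIn⇒∈ (x ∷ S)    (suc i) Si with u , refl , u∈S ← isIn⇒∈ S i Si = suc u , refl , there u∈S

edgeOutside : (ℕ → Bool) → ℕ × ℕ → Bool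
edgeOutside S (a , b) = not (S a ∧ S b)

independentᵇ : ∀ {n} → List (ℕ × ℕ) → Subset n → Bool
independentᵇ E S = all (edgeOutside (isIn S)) E

EdgeIndependent : ∀ {n} → List (ℕ × ℕ) → Subset n → Set
EdgeIndependent E S = ∀ u v → u ∈ S → v ∈ S → ¬ ((toℕ u , toℕ v) ∈ₗ E ⊎ (toℕ v , toℕ u) ∈ₗ E)

EdgeIndependent⇔independentᵇ : ∀ {n} E (S : Subset n) → EdgeIndependent E S ⇔ T (independentᵇ E S)
EdgeIndependent⇔independentᵇ E S = mk⇔ to from
  where
  nand : ∀ {x y} → T (not (x ∧ y)) → T x → T y → ⊥
  nand {true} {true} ()

  nand⁻ : ∀ {x y} → (T x → T y → ⊥) → T (not (x ∧ y))
  nand⁻ {true}  {true}  x⇏y = x⇏y _ _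
  nand⁻ {true}  {false} _   = _
  nand⁻ {false}         _   = _

  to : EdgeIndependent E S → T (independentᵇ E S)
  to indep = all⁻ (edgeOutside (isIn S)) {E} (All.tabulate λ {(a , b)} ab∈E → nand⁻ λ Sa Sb →
    let u , u≡a , u∈S = isIn⇒∈ S a Sa
        v , v≡b , v∈S = isIn⇒∈ S b Sb
    in indep u v u∈S v∈S (inj₁ (subst (_∈ₗ E) (cong₂ _,_ (sym u≡a) (sym v≡b)) ab∈E)))

  from : T (independentᵇ E S) → EdgeIndependent E S
  from indep u v u∈S v∈S (inj₁ uv∈E) =
    nand (All.lookup (all⁺ (edgeOutside (isIn S)) E indep) uv∈E) (∈⇒isIn u∈S) (∈⇒isIn v∈S)
  from indep u v u∈S v∈S (inj₂ vu∈E) =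
    nand (All.lookup (all⁺ (edgeOutside (isIn S)) E indep) vu∈E) (∈⇒isIn v∈S) (∈⇒isIn u∈S)

-- Independent (tree k) is, by definition, EdgeIndependent (treeEdges k).
does-independent?-tree : ∀ k S → does (independent? (tree k) S) ≡ independentᵇ (treeEdges k) S
does-independent?-tree k S =
  does-⇔ (EdgeIndependent⇔independentᵇ (treeEdges k) S) (independent? (tree k) S) (T? _)

all-++ : ∀ {a} {A : Set a} (p : A → Bool) xs ys → all p (xs ++ₗ ys) ≡ all p xs ∧ all p ys
all-++ p []       ys = refl
all-++ p (x ∷ xs) ys = trans (cong (p x ∧_) (all-++ p xs ys)) (sym (∧-assoc (p x) _ _))

-- S 0, S 1 is the first pendant K₂ (S 0 adjacent to the hub), S 2, S 3 the second, and so on;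
-- hub records whether the hub itself is in the set.
pendantsFree : Bool → ℕ → (ℕ → Bool) → Bool
pendantsFree hub zero    S = true
pendantsFree hub (suc m) S = not (hub ∧ S 0) ∧ (not (S 0 ∧ S 1) ∧ pendantsFree hub m (S ∘ (2 +_)))

pendantsFree-cong : ∀ hub m {S S′ : ℕ → Bool} → (∀ q → S q ≡ S′ q) →
  pendantsFree hub m S ≡ pendantsFree hub m S′
pendantsFree-cong hub zero    S≗S′ = refl
pendantsFree-cong hub (suc m) S≗S′ =
  cong₂ (λ x F → not (hub ∧ x) ∧ F) (S≗S′ 0)
    (cong₂ _∧_ (cong₂ (λ x y → not (x ∧ y)) (S≗S′ 0) (S≗S′ 1))
               (pendantsFree-cong hub m (S≗S′ ∘ (2 +_))))

pendantEdges : ℕ → ℕ → ℕ → List (ℕ × ℕ)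
pendantEdges hub o m = concatMap (λ i → pendantK2 hub (o + 2 * i)) (upTo m)

pendantEdges-suc : ∀ hub o m →
  pendantEdges hub o (suc m) ≡ pendantK2 hub (o + 2 * 0) ++ₗ pendantEdges hub (o + 2) m
pendantEdges-suc hub o m = cong (pendantK2 hub (o + 2 * 0) ++ₗ_) (begin
  concatMap f (applyUpTo suc m)        ≡⟨ cong (concatMap f) (sym (map-upTo suc m)) ⟩
  concatMap f (map suc (upTo m))       ≡⟨ concatMap-map f suc (upTo m) ⟩
  concatMap (f ∘ suc) (upTo m)         ≡⟨ concatMap-cong (λ i → cong (pendantK2 hub) (shift o i)) (upTo m) ⟩
  pendantEdges hub (o + 2) m           ∎)
  where
  open ≡-Reasoning
  f : ℕ → List (ℕ × ℕ)
  f i = pendantK2 hub (o + 2 * i)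
  shift : ∀ o i → o + 2 * suc i ≡ o + 2 + 2 * i
  shift = solve-∀

all-pendantEdges : ∀ (S : ℕ → Bool) hub o m →
  all (edgeOutside S) (pendantEdges hub o m) ≡ pendantsFree (S hub) m (S ∘ (o +_))
all-pendantEdges S hub o zero    = refl
all-pendantEdges S hub o (suc m) = begin
  all (edgeOutside S) (pendantEdges hub o (suc m))
    ≡⟨ cong (all (edgeOutside S)) (pendantEdges-suc hub o m) ⟩
  not (S hub ∧ a) ∧ (not (a ∧ S (suc (o + 0))) ∧ all (edgeOutside S) (pendantEdges hub (o + 2) m))
    ≡⟨ cong₂ (λ x F → not (S hub ∧ a) ∧ (not (a ∧ x) ∧ F))
         (cong S (sym (+-suc o 0)))
         (trans (all-pendantEdges S hub (o + 2) m) (pendantsFree-cong (S hub) m (cong S ∘ +-assoc o 2))) ⟩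
  pendantsFree (S hub) (suc m) (S ∘ (o +_)) ∎
  where
  open ≡-Reasoning
  a = S (o + 0)

double : ℕ → ℕ
double zero    = zero
double (suc m) = suc (suc (double m))

double≡2* : ∀ m → double m ≡ 2 * m
double≡2* zero    = refl
double≡2* (suc m) = trans (cong (2 +_) (double≡2* m)) (sym (*-suc 2 m))

double+double≡4* : ∀ m → double m + double m ≡ 4 * m
double+double≡4* m = begin
  double m + double m ≡⟨ cong₂ _+_ (double≡2* m) (double≡2* m) ⟩
  2 * m + 2 * m       ≡⟨ 2m+2m≡4m m ⟩
  4 * m               ∎
  where
  open ≡-Reasoning
  2m+2m≡4m : ∀ m → 2 * m + 2 * m ≡ 4 * m
  2m+2m≡4m = solve-∀

isIn-subst : ∀ {m n} (m≡n : m ≡ n) (S : Subset m) i → isIn (subst Subset m≡n S) i ≡ isIn S i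
isIn-subst refl S i = refl

isIn-++ʳ : ∀ {m n} (u : Subset m) (v : Subset n) i → isIn (u ++ v) (m + i) ≡ isIn v i
isIn-++ʳ []      v i = refl
isIn-++ʳ (x ∷ u) v i = isIn-++ʳ u v i

pendantsFree-++ : ∀ hub m (u : Subset (double m)) {n} (v : Subset n) →
  pendantsFree hub m (isIn (u ++ v)) ≡ pendantsFree hub m (isIn u)
pendantsFree-++ hub zero    []          v = refl
pendantsFree-++ hub (suc m) (x ∷ y ∷ u) v =
  cong (λ F → not (hub ∧ x) ∧ (not (x ∧ y) ∧ F)) (pendantsFree-++ hub m u v)

∣∣-++ : ∀ {m n} (u : Subset m) (v : Subset n) → ∣ u ++ v ∣ ≡ ∣ u ∣ + ∣ v ∣
∣∣-++ []           v = refl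
∣∣-++ (false ∷ u) v = ∣∣-++ u v
∣∣-++ (true ∷ u)  v = cong suc (∣∣-++ u v)

∣∣-subst : ∀ {m n} (m≡n : m ≡ n) (S : Subset m) → ∣ subst Subset m≡n S ∣ ≡ ∣ S ∣
∣∣-subst refl S = refl

∣∣≤-pendantsFree : ∀ hub m (u : Subset (double m)) → T (pendantsFree hub m (isIn u)) → ∣ u ∣ ≤ m
∣∣≤-pendantsFree hub zero    []          _    = z≤n
∣∣≤-pendantsFree hub (suc m) (x ∷ y ∷ u) free
  with x | y | proj₂ (Equivalence.to (T-∧ {not (hub ∧ x)}) free)
... | false | false | rest = m≤n⇒m≤1+n (∣∣≤-pendantsFree hub m u rest)
... | false | true  | rest = s≤s (∣∣≤-pendantsFree hub m u rest)
... | true  | false | rest = s≤s (∣∣≤-pendantsFree hub m u rest)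

sumPendants : Bool → (m : ℕ) → (ℕ → ℕ) → ℕ
sumPendants hub m f = sumWhere (double m) (pendantsFree hub m ∘ isIn) (f ∘ ∣_∣)

-- Each pendant K₂ contributes a factor 1 + x + x (one of its two vertices) when the hub is
-- free and 1 + x (only the outer vertex) when the hub is taken.
sumPendants-suc : ∀ hub m (f : ℕ → ℕ) →
  sumPendants hub (suc m) f ≡
  sumPendants hub m f + sumPendants hub m (f ∘ suc) + (if hub then 0 else sumPendants hub m (f ∘ suc))
sumPendants-suc false m f =
  trans (sumSubsets-suc-suc (double m) _)
        (cong (skipFirst + takeFirst +_)
              (trans (cong (takeFirst +_) (sumSubsets-zero (double m) λ _ → refl)) (+-identityʳ takeFirst)))
  where
  skipFirst = sumPendants false m f
  takeFirst = sumPendants false m (f ∘ suc)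
sumPendants-suc true m f =
  trans (sumSubsets-suc-suc (double m) _)
        (cong (sumPendants true m f + sumPendants true m (f ∘ suc) +_)
              (cong₂ _+_ (sumSubsets-zero (double m) λ _ → refl) (sumSubsets-zero (double m) λ _ → refl)))

pendantCount : Bool → ℕ → ℕ → ℕ
pendantCount hub m p = sumPendants hub m (hasSize p)

pendantCount-oversized : ∀ hub m p → m < p → pendantCount hub m p ≡ 0
pendantCount-oversized hub m p m<p = sumWhere-zero (double m) _ λ u free →
  𝟙-false λ ∣u∣≡p → <⇒≢ (≤-<-trans (∣∣≤-pendantsFree hub m u free) m<p) (≡ᵇ⇒≡ _ _ ∣u∣≡p)

pendantCount-maximum-hubFree : ∀ m → pendantCount false m m ≡ 2 ^ m
pendantCount-maximum-hubFree zero    = sumSubsets-[] _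
pendantCount-maximum-hubFree (suc m) = begin
  pendantCount false (suc m) (suc m)
    ≡⟨ sumPendants-suc false m (hasSize (suc m)) ⟩
  pendantCount false m (suc m) + pendantCount false m m + pendantCount false m m
    ≡⟨ cong₂ (λ a b → a + b + b)
             (pendantCount-oversized false m (suc m) ≤-refl) (pendantCount-maximum-hubFree m) ⟩
  2 ^ m + 2 ^ m
    ≡⟨ cong (2 ^ m +_) (sym (+-identityʳ (2 ^ m))) ⟩
  2 ^ suc m ∎
  where open ≡-Reasoning

pendantCount-maximum-hubTaken : ∀ m → pendantCount true m m ≡ 1
pendantCount-maximum-hubTaken zero    = sumSubsets-[] _
pendantCount-maximum-hubTaken (suc m) =
  trans (sumPendants-suc true m (hasSize (suc m)))
        (cong₂ (λ a b → a + b + 0)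
               (pendantCount-oversized true m (suc m) ≤-refl) (pendantCount-maximum-hubTaken m))

pendantCount-submaximum-hubTaken : ∀ m → pendantCount true (suc m) m ≡ suc m
pendantCount-submaximum-hubTaken zero    =
  trans (sumPendants-suc true 0 (hasSize 0)) (cong₂ (λ a b → a + b + 0) (sumSubsets-[] _) (sumSubsets-[] _))
pendantCount-submaximum-hubTaken (suc m) =
  trans (sumPendants-suc true (suc m) (hasSize (suc m)))
        (trans (cong₂ (λ a b → a + b + 0)
                      (pendantCount-maximum-hubTaken (suc m)) (pendantCount-submaximum-hubTaken m))
               (+-identityʳ (2 + m)))

coreEdges : List (ℕ × ℕ)
coreEdges = (0 , 1) ∷ (0 , 2) ∷ (0 , 3) ∷ (1 , 4) ∷ (4 , 5) ∷ (5 , 6) ∷ (6 , 7) ∷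
            pendantK2 1 8 ++ₗ pendantK2 1 10

coreFree : Subset 12 → Bool
coreFree = independentᵇ coreEdges

independentᵇ-tree : ∀ k (c : Subset 12) (w : Subset (4 * k)) →
  independentᵇ (treeEdges k) (c ++ w) ≡
  coreFree c ∧ (pendantsFree (isIn c 2) k (isIn w) ∧ pendantsFree (isIn c 3) k (isIn w ∘ (2 * k +_)))
independentᵇ-tree k c@(_ ∷ _ ∷ _ ∷ _ ∷ _ ∷ _ ∷ _ ∷ _ ∷ _ ∷ _ ∷ _ ∷ _ ∷ []) w =
  trans (all-++ p coreEdges (pendantEdges 2 12 k ++ₗ pendantEdges 3 (12 + 2 * k) k))
        (cong (coreFree c ∧_) (trans (all-++ p (pendantEdges 2 12 k) _)
          (cong₂ _∧_ (all-pendantEdges S 2 12 k) (all-pendantEdges S 3 (12 + 2 * k) k))))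
  where
  S = isIn (c ++ w)
  p = edgeOutside S

joinPendants : ∀ k → Subset (double k) → Subset (double k) → Subset (4 * k)
joinPendants k u v = subst Subset (double+double≡4* k) (u ++ v)

independentᵇ-joinPendants : ∀ k c u v →
  independentᵇ (treeEdges k) (c ++ joinPendants k u v) ≡
  coreFree c ∧ (pendantsFree (isIn c 2) k (isIn u) ∧ pendantsFree (isIn c 3) k (isIn v))
independentᵇ-joinPendants k c u v =
  trans (independentᵇ-tree k c w) (cong (coreFree c ∧_) (cong₂ _∧_ first second))
  where
  open ≡-Reasoning
  w = joinPendants k u v
  first : pendantsFree (isIn c 2) k (isIn w) ≡ pendantsFree (isIn c 2) k (isIn u)
  first = trans (pendantsFree-cong _ k (isIn-subst (double+double≡4* k) (u ++ v)))
                (pendantsFree-++ _ k u v)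
  second : pendantsFree (isIn c 3) k (isIn w ∘ (2 * k +_)) ≡ pendantsFree (isIn c 3) k (isIn v)
  second = pendantsFree-cong _ k λ q → begin
    isIn w (2 * k + q)              ≡⟨ isIn-subst (double+double≡4* k) (u ++ v) (2 * k + q) ⟩
    isIn (u ++ v) (2 * k + q)       ≡⟨ cong (λ o → isIn (u ++ v) (o + q)) (sym (double≡2* k)) ⟩
    isIn (u ++ v) (double k + q)    ≡⟨ isIn-++ʳ u v q ⟩
    isIn v q                        ∎

∣∣-joinPendants : ∀ {m} k (c : Subset m) u v → ∣ c ++ joinPendants k u v ∣ ≡ ∣ c ∣ + (∣ u ∣ + ∣ v ∣)
∣∣-joinPendants k c u v =
  trans (∣∣-++ c _) (cong (∣ c ∣ +_) (trans (∣∣-subst (double+double≡4* k) (u ++ v)) (∣∣-++ u v)))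

-- The number of ways to extend an independent core set with s vertices, containing v₂ iff
-- h₂ and v₃ iff h₃, by pendant vertices to an independent set with j vertices.
extensionCount : ℕ → Bool → Bool → ℕ → ℕ → ℕ
extensionCount k h₂ h₃ s j =
  sumWhere (double k) (pendantsFree h₂ k ∘ isIn) λ u →
  sumWhere (double k) (pendantsFree h₃ k ∘ isIn) λ v → hasSize j (s + (∣ u ∣ + ∣ v ∣))

treeWeight : ∀ k j → Subset (12 + 4 * k) → ℕ
treeWeight k j S = if independentᵇ (treeEdges k) S then hasSize j ∣ S ∣ else 0

sum-treeWeight-pendants : ∀ k j c →
  sumSubsets (double k) (λ u → sumSubsets (double k) λ v → treeWeight k j (c ++ joinPendants k u v)) ≡
  (if coreFree c then extensionCount k (isIn c 2) (isIn c 3) ∣ c ∣ j else 0)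
sum-treeWeight-pendants k j c = begin
  sumSubsets (double k) (λ u → sumSubsets (double k) λ v → treeWeight k j (c ++ joinPendants k u v))
    ≡⟨ sumSubsets-cong (double k) (λ u → sumSubsets-cong (double k) (λ v → nested u v)) ⟩
  sumSubsets (double k) (λ u → sumSubsets (double k) λ v → if coreFree c then F u v else 0)
    ≡⟨ sumSubsets-cong (double k) (λ u → sumSubsets-if (double k) (coreFree c) (F u)) ⟩
  sumSubsets (double k) (λ u → if coreFree c then sumSubsets (double k) (F u) else 0)
    ≡⟨ sumSubsets-if (double k) (coreFree c) _ ⟩
  (if coreFree c then sumSubsets (double k) (λ u → sumSubsets (double k) (F u)) else 0)
    ≡⟨ cong (if coreFree c then_else 0) (sumSubsets-cong (double k) λ u →
         sumSubsets-if (double k) (pendantsFree (isIn c 2) k (isIn u)) _) ⟩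
  (if coreFree c then extensionCount k (isIn c 2) (isIn c 3) ∣ c ∣ j else 0) ∎
  where
  open ≡-Reasoning
  F : Subset (double k) → Subset (double k) → ℕ
  F u v = if pendantsFree (isIn c 2) k (isIn u)
          then (if pendantsFree (isIn c 3) k (isIn v) then hasSize j (∣ c ∣ + (∣ u ∣ + ∣ v ∣)) else 0)
          else 0
  nested : ∀ u v → treeWeight k j (c ++ joinPendants k u v) ≡ (if coreFree c then F u v else 0)
  nested u v
    rewrite independentᵇ-joinPendants k c u v | ∣∣-joinPendants k c u v
          | if-∧ (coreFree c) (pendantsFree (isIn c 2) k (isIn u) ∧ pendantsFree (isIn c 3) k (isIn v))
                 {hasSize j (∣ c ∣ + (∣ u ∣ + ∣ v ∣))}
          | if-∧ (pendantsFree (isIn c 2) k (isIn u)) (pendantsFree (isIn c 3) k (isIn v))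
                 {hasSize j (∣ c ∣ + (∣ u ∣ + ∣ v ∣))}
    = refl

indepCount-tree : ∀ k j →
  indepCount (tree k) j ≡ sumWhere 12 coreFree (λ c → extensionCount k (isIn c 2) (isIn c 3) ∣ c ∣ j)
indepCount-tree k j = begin
  indepCount (tree k) j
    ≡⟨ indepCount-sumWhere (tree k) j ⟩
  sumWhere (12 + 4 * k) (does ∘ independent? (tree k)) (hasSize j ∘ ∣_∣)
    ≡⟨ sumSubsets-cong (12 + 4 * k) (λ S →
         cong (if_then hasSize j ∣ S ∣ else 0) (does-independent?-tree k S)) ⟩
  sumSubsets (12 + 4 * k) (treeWeight k j)
    ≡⟨ sumSubsets-++ 12 (4 * k) (treeWeight k j) ⟩
  sumSubsets 12 (λ c → sumSubsets (4 * k) (λ w → treeWeight k j (c ++ w)))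
    ≡⟨ sumSubsets-cong 12 (λ c → sumSubsets-subst (double+double≡4* k) _) ⟩
  sumSubsets 12 (λ c → sumSubsets (double k + double k) (λ w → treeWeight k j (c ++ subst Subset _ w)))
    ≡⟨ sumSubsets-cong 12 (λ c → sumSubsets-++ (double k) (double k) _) ⟩
  sumSubsets 12 (λ c → sumSubsets (double k) λ u → sumSubsets (double k) λ v →
                          treeWeight k j (c ++ joinPendants k u v))
    ≡⟨ sumSubsets-cong 12 (sum-treeWeight-pendants k j) ⟩
  sumWhere 12 coreFree (λ c → extensionCount k (isIn c 2) (isIn c 3) ∣ c ∣ j) ∎
  where open ≡-Reasoning

module _ (k : ℕ) (h₂ h₃ : Bool) (s j : ℕ) where

  private
    free₂ free₃ : Subset (double k) → Bool
    free₂ = pendantsFree h₂ k ∘ isIn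
    free₃ = pendantsFree h₃ k ∘ isIn

  extensionCount-beyond : s + (k + k) < j → extensionCount k h₂ h₃ s j ≡ 0
  extensionCount-beyond s+2k<j =
    sumWhere-zero (double k) free₂ λ u u-free → sumWhere-zero (double k) free₃ λ v v-free →
      hasSize-beyond {s} (∣∣≤-pendantsFree h₂ k u u-free) (∣∣≤-pendantsFree h₃ k v v-free) s+2k<j

  extensionCount-maximum : s + (k + k) ≡ j →
    extensionCount k h₂ h₃ s j ≡ pendantCount h₂ k k * pendantCount h₃ k k
  extensionCount-maximum s+2k≡j = trans
    (sumWhere-cong (double k) free₂ λ u u-free → sumWhere-cong (double k) free₃ λ v v-free →
      hasSize-maximum {s} (∣∣≤-pendantsFree h₂ k u u-free) (∣∣≤-pendantsFree h₃ k v v-free) s+2k≡j)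
    (sumWhere-product (double k) (double k) free₂ free₃ (hasSize k ∘ ∣_∣) (hasSize k ∘ ∣_∣))

module _ (m : ℕ) (h₂ h₃ : Bool) (s j : ℕ) where

  private
    free₂ free₃ : Subset (double (suc m)) → Bool
    free₂ = pendantsFree h₂ (suc m) ∘ isIn
    free₃ = pendantsFree h₃ (suc m) ∘ isIn

  extensionCount-submaximum : s + (suc m + suc m) ≡ suc j →
    extensionCount (suc m) h₂ h₃ s j ≤
    pendantCount h₂ (suc m) (suc m) * pendantCount h₃ (suc m) m +
    pendantCount h₂ (suc m) m * pendantCount h₃ (suc m) (suc m)
  extensionCount-submaximum s+2k≡1+j = begin
    extensionCount (suc m) h₂ h₃ s j
      ≤⟨ sumWhere-mono-≤ (double (suc m)) free₂ (λ u u-free → sumWhere-mono-≤ (double (suc m)) free₃ λ v v-free →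
           hasSize-submaximum {s} (∣∣≤-pendantsFree h₂ (suc m) u u-free) (∣∣≤-pendantsFree h₃ (suc m) v v-free)
                              s+2k≡1+j) ⟩
    sumWhere _ free₂ (λ u → sumWhere _ free₃ λ v → full u * short v + short u * full v)
      ≡⟨ sumWhere-cong (double (suc m)) free₂ (λ u _ → sumWhere-distrib-+ (double (suc m)) free₃ _ _) ⟩
    sumWhere _ free₂ (λ u → sumWhere _ free₃ (λ v → full u * short v) + sumWhere _ free₃ (λ v → short u * full v))
      ≡⟨ sumWhere-distrib-+ (double (suc m)) free₂ _ _ ⟩
    sumWhere _ free₂ (λ u → sumWhere _ free₃ (λ v → full u * short v)) +
    sumWhere _ free₂ (λ u → sumWhere _ free₃ (λ v → short u * full v))
      ≡⟨ cong₂ _+_ (sumWhere-product _ _ free₂ free₃ full short) (sumWhere-product _ _ free₂ free₃ short full) ⟩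
    pendantCount h₂ (suc m) (suc m) * pendantCount h₃ (suc m) m +
    pendantCount h₂ (suc m) m * pendantCount h₃ (suc m) (suc m) ∎
    where
    open ≤-Reasoning
    full short : Subset (double (suc m)) → ℕ
    full  = hasSize (suc m) ∘ ∣_∣
    short = hasSize m ∘ ∣_∣

CoreProfile : Bool → Bool → ℕ → Set
CoreProfile h₂ h₃ s = s ≤ 5 ⊎ (s ≡ 6 × T (h₂ ∨ h₃)) ⊎ (s ≡ 7 × T (h₂ ∧ h₃))

coreProfile? : ∀ h₂ h₃ s → Dec (CoreProfile h₂ h₃ s)
coreProfile? h₂ h₃ s = s ≤? 5 ⊎-dec ((s ≟ 6) ×-dec T? (h₂ ∨ h₃)) ⊎-dec ((s ≟ 7) ×-dec T? (h₂ ∧ h₃))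

coreProfile : ∀ c → T (coreFree c) → CoreProfile (isIn c 2) (isIn c 3) ∣ c ∣
coreProfile c c-free =
  decidable-stable (coreProfile? (isIn c 2) (isIn c 3) ∣ c ∣) λ ¬profile →
    noViolation (c , c-free , ¬profile)
  where
  Violation : Subset 12 → Set
  Violation c = T (coreFree c) × ¬ CoreProfile (isIn c 2) (isIn c 3) ∣ c ∣
  noViolation : ¬ ∃ Violation
  noViolation =
    toWitnessFalse {a? = anySubset? λ c →
      T? (coreFree c) ×-dec ¬? (coreProfile? (isIn c 2) (isIn c 3) ∣ c ∣)} _

coreCount : (Bool → Bool → ℕ → Bool) → ℕ
coreCount Q = sumWhere 12 coreFree λ c → 𝟙 (Q (isIn c 2) (isIn c 3) ∣ c ∣)

hubsTaken oneHubTaken hubsFree : ℕ → Bool → Bool → ℕ → Bool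
hubsTaken   n h₂ h₃ s = (h₂ ∧ h₃) ∧ (s ≡ᵇ n)
oneHubTaken n h₂ h₃ s = (h₂ xor h₃) ∧ (s ≡ᵇ n)
hubsFree    n h₂ h₃ s = not (h₂ ∨ h₃) ∧ (s ≡ᵇ n)

opaque
  unfolding sumSubsets

  coreCount-hubsFree-5 : coreCount (hubsFree 5) ≡ 13
  coreCount-hubsFree-5 = refl

  coreCount-oneHubTaken-6 : coreCount (oneHubTaken 6) ≡ 2
  coreCount-oneHubTaken-6 = refl

  coreCount-hubsTaken-6 : coreCount (hubsTaken 6) ≡ 17
  coreCount-hubsTaken-6 = refl

  coreCount-hubsTaken-7 : coreCount (hubsTaken 7) ≡ 1
  coreCount-hubsTaken-7 = refl

indepCount-tree-≥ : ∀ k j (Q : Bool → Bool → ℕ → Bool) X →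
  (∀ h₂ h₃ s → T (Q h₂ h₃ s) → X ≤ extensionCount k h₂ h₃ s j) →
  coreCount Q * X ≤ indepCount (tree k) j
indepCount-tree-≥ k j Q X bound = begin
  coreCount Q * X
    ≡⟨ *-distribʳ-sumWhere 12 coreFree X _ ⟩
  sumWhere 12 coreFree (λ c → 𝟙 (Q (isIn c 2) (isIn c 3) ∣ c ∣) * X)
    ≤⟨ sumWhere-mono-≤ 12 coreFree (λ c _ → 𝟙-*-≤ (bound (isIn c 2) (isIn c 3) ∣ c ∣)) ⟩
  sumWhere 12 coreFree (λ c → extensionCount k (isIn c 2) (isIn c 3) ∣ c ∣ j)
    ≡⟨ indepCount-tree k j ⟨
  indepCount (tree k) j ∎
  where open ≤-Reasoning

indepCount-tree-2k+5 : ∀ k → 13 * (2 ^ k * 2 ^ k) ≤ indepCount (tree k) (2 * k + 5)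
indepCount-tree-2k+5 k =
  subst (λ a → a * (2 ^ k * 2 ^ k) ≤ indepCount (tree k) (2 * k + 5)) coreCount-hubsFree-5
  (indepCount-tree-≥ k (2 * k + 5) (hubsFree 5) (2 ^ k * 2 ^ k) bound)
  where
  bound : ∀ h₂ h₃ s → T (hubsFree 5 h₂ h₃ s) → 2 ^ k * 2 ^ k ≤ extensionCount k h₂ h₃ s (2 * k + 5)
  bound false false s s≡5 rewrite ≡ᵇ⇒≡ s 5 s≡5 = ≤-reflexive (sym (trans
    (extensionCount-maximum k false false 5 (2 * k + 5) (s+[k+k]≡2k+s k 5))
    (cong₂ _*_ (pendantCount-maximum-hubFree k) (pendantCount-maximum-hubFree k))))

indepCount-tree-2k+7 : ∀ k → 1 ≤ indepCount (tree k) (2 * k + 7)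
indepCount-tree-2k+7 k =
  subst (λ a → a * 1 ≤ indepCount (tree k) (2 * k + 7)) coreCount-hubsTaken-7
  (indepCount-tree-≥ k (2 * k + 7) (hubsTaken 7) 1 bound)
  where
  bound : ∀ h₂ h₃ s → T (hubsTaken 7 h₂ h₃ s) → 1 ≤ extensionCount k h₂ h₃ s (2 * k + 7)
  bound true true s s≡7 rewrite ≡ᵇ⇒≡ s 7 s≡7 = ≤-reflexive (sym (trans
    (extensionCount-maximum k true true 7 (2 * k + 7) (s+[k+k]≡2k+s k 7))
    (cong₂ _*_ (pendantCount-maximum-hubTaken k) (pendantCount-maximum-hubTaken k))))

extensionCount-2k+6 : ∀ m → let k = suc m in ∀ h₂ h₃ s → CoreProfile h₂ h₃ s →
  extensionCount k h₂ h₃ s (2 * k + 6) ≤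
  𝟙 (hubsTaken 6 h₂ h₃ s) + 2 ^ k * 𝟙 (oneHubTaken 6 h₂ h₃ s) + (k + k) * 𝟙 (hubsTaken 7 h₂ h₃ s)
extensionCount-2k+6 m h₂ h₃ s (inj₁ s≤5) = ≤-trans (≤-reflexive (extensionCount-beyond (suc m) h₂ h₃ s _
  (≤-trans (s≤s (+-monoˡ-≤ (suc m + suc m) s≤5)) (≤-reflexive (s+[k+k]≡2k+s (suc m) 6))))) z≤n
extensionCount-2k+6 m true true _ (inj₂ (inj₁ (refl , _))) = ≤-trans
  (≤-reflexive (trans (extensionCount-maximum (suc m) true true 6 _ (s+[k+k]≡2k+s (suc m) 6))
    (cong₂ _*_ (pendantCount-maximum-hubTaken (suc m)) (pendantCount-maximum-hubTaken (suc m)))))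
  (≤-trans (m≤m+n 1 (2 ^ suc m * 0)) (m≤m+n _ _))
extensionCount-2k+6 m true false _ (inj₂ (inj₁ (refl , _))) = ≤-trans
  (≤-reflexive (trans (extensionCount-maximum (suc m) true false 6 _ (s+[k+k]≡2k+s (suc m) 6))
    (trans (cong₂ _*_ (pendantCount-maximum-hubTaken (suc m)) (pendantCount-maximum-hubFree (suc m)))
           (*-comm 1 (2 ^ suc m)))))
  (m≤m+n (2 ^ suc m * 1) _)
extensionCount-2k+6 m false true _ (inj₂ (inj₁ (refl , _))) = ≤-trans
  (≤-reflexive (trans (extensionCount-maximum (suc m) false true 6 _ (s+[k+k]≡2k+s (suc m) 6))
    (cong₂ _*_ (pendantCount-maximum-hubFree (suc m)) (pendantCount-maximum-hubTaken (suc m)))))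
  (m≤m+n (2 ^ suc m * 1) _)
extensionCount-2k+6 m true true _ (inj₂ (inj₂ (refl , _))) = ≤-trans
  (extensionCount-submaximum m true true 7 _ (cong suc (s+[k+k]≡2k+s (suc m) 6)))
  (≤-trans (≤-reflexive (trans (cong₂ (λ a b → a * b + b * a)
                                      (pendantCount-maximum-hubTaken (suc m)) (pendantCount-submaximum-hubTaken m))
                               (1*k+k*1≡[k+k]*1 (suc m))))
           (m≤n+m ((suc m + suc m) * 1) _))
  where
  1*k+k*1≡[k+k]*1 : ∀ k → 1 * k + k * 1 ≡ (k + k) * 1
  1*k+k*1≡[k+k]*1 = solve-∀

indepCount-tree-2k+6 : ∀ m → let k = suc m in indepCount (tree k) (2 * k + 6) ≤ 17 + 2 * 2 ^ k + 2 * k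
indepCount-tree-2k+6 m = begin
  indepCount (tree k) (2 * k + 6)
    ≡⟨ indepCount-tree k (2 * k + 6) ⟩
  sumWhere 12 coreFree (λ c → extensionCount k (isIn c 2) (isIn c 3) ∣ c ∣ (2 * k + 6))
    ≤⟨ sumWhere-mono-≤ 12 coreFree (λ c c-free →
         extensionCount-2k+6 m (isIn c 2) (isIn c 3) ∣ c ∣ (coreProfile c c-free)) ⟩
  sumWhere 12 coreFree (λ c → e₁ c + 2 ^ k * e₂ c + (k + k) * e₃ c)
    ≡⟨ sumWhere-distrib-+ 12 coreFree _ _ ⟩
  sumWhere 12 coreFree (λ c → e₁ c + 2 ^ k * e₂ c) + sumWhere 12 coreFree (λ c → (k + k) * e₃ c)
    ≡⟨ cong₂ _+_ (trans (sumWhere-distrib-+ 12 coreFree _ _)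
                        (cong (coreCount (hubsTaken 6) +_) (sym (*-distribˡ-sumWhere 12 coreFree (2 ^ k) e₂))))
                 (sym (*-distribˡ-sumWhere 12 coreFree (k + k) e₃)) ⟩
  coreCount (hubsTaken 6) + 2 ^ k * coreCount (oneHubTaken 6) + (k + k) * coreCount (hubsTaken 7)
    ≡⟨ cong₂ (λ ab c → ab + (k + k) * c)
             (cong₂ (λ a b → a + 2 ^ k * b) coreCount-hubsTaken-6 coreCount-oneHubTaken-6) coreCount-hubsTaken-7 ⟩
  17 + 2 ^ k * 2 + (k + k) * 1
    ≡⟨ normalise (2 ^ k) k ⟩
  17 + 2 * 2 ^ k + 2 * k ∎
  where
  open ≤-Reasoning
  k = suc m
  e₁ e₂ e₃ : Subset 12 → ℕ
  e₁ c = 𝟙 (hubsTaken 6 (isIn c 2) (isIn c 3) ∣ c ∣)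
  e₂ c = 𝟙 (oneHubTaken 6 (isIn c 2) (isIn c 3) ∣ c ∣)
  e₃ c = 𝟙 (hubsTaken 7 (isIn c 2) (isIn c 3) ∣ c ∣)
  normalise : ∀ a k → 17 + a * 2 + (k + k) * 1 ≡ 17 + 2 * a + 2 * k
  normalise = solve-∀

2[5+t]+17≤2^[5+t] : ∀ t → 2 * (5 + t) + 17 ≤ 2 ^ (5 + t)
2[5+t]+17≤2^[5+t] zero    = ≤ᵇ⇒≤ 27 32 _
2[5+t]+17≤2^[5+t] (suc t) = begin
  2 * (6 + t) + 17          ≡⟨ regroup t ⟩
  (2 * (5 + t) + 17) + 2    ≤⟨ +-mono-≤ ih (≤-trans (≤-trans (s≤s (s≤s z≤n)) (m≤n+m 17 (2 * (5 + t)))) ih) ⟩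
  A + A                     ≡⟨ cong (A +_) (+-identityʳ A) ⟨
  2 ^ (6 + t)               ∎
  where
  open ≤-Reasoning
  A = 2 ^ (5 + t)
  ih = 2[5+t]+17≤2^[5+t] t
  regroup : ∀ t → 2 * (6 + t) + 17 ≡ (2 * (5 + t) + 17) + 2
  regroup = solve-∀

coefficientGap : ∀ k → 4 ≤ k →
  (17 + 2 * 2 ^ k + 2 * k) * (17 + 2 * 2 ^ k + 2 * k) < 13 * (2 ^ k * 2 ^ k)
coefficientGap 1 (s≤s ())
coefficientGap 2 (s≤s (s≤s ()))
coefficientGap 3 (s≤s (s≤s (s≤s ())))
coefficientGap 4 _ = ≤ᵇ⇒≤ 3250 3328 _
coefficientGap k@(suc (suc (suc (suc (suc t))))) _ = begin-strict
  B * B                      ≤⟨ *-mono-≤ B≤3A B≤3A ⟩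
  (3 * A) * (3 * A)          ≡⟨ square A ⟩
  9 * (A * A) + 0            <⟨ +-monoʳ-< (9 * (A * A)) (≤-trans (s≤s z≤n) (*-monoʳ-≤ 4 (*-mono-≤ 1≤A 1≤A))) ⟩
  9 * (A * A) + 4 * (A * A)  ≡⟨ 9X+4X≡13X (A * A) ⟩
  13 * (A * A)               ∎
  where
  open ≤-Reasoning
  A = 2 ^ k
  B = 17 + 2 * A + 2 * k
  1≤A : 1 ≤ A
  1≤A = ≤-trans (s≤s z≤n) (2[5+t]+17≤2^[5+t] t)
  B≤3A : B ≤ 3 * A
  B≤3A = begin
    17 + 2 * A + 2 * k    ≡⟨ regroup A k ⟩
    2 * A + (2 * k + 17)  ≤⟨ +-monoʳ-≤ (2 * A) (2[5+t]+17≤2^[5+t] t) ⟩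
    2 * A + A             ≡⟨ 2A+A≡3A A ⟩
    3 * A                 ∎
    where
    regroup : ∀ A k → 17 + 2 * A + 2 * k ≡ 2 * A + (2 * k + 17)
    regroup = solve-∀
    2A+A≡3A : ∀ A → 2 * A + A ≡ 3 * A
    2A+A≡3A = solve-∀
  square : ∀ A → (3 * A) * (3 * A) ≡ 9 * (A * A) + 0
  square = solve-∀
  9X+4X≡13X : ∀ X → 9 * X + 4 * X ≡ 13 * X
  9X+4X≡13X = solve-∀

mainTheorem5 : (k : ℕ) → 4 ≤ k → ¬ IndepPolyLogConcave (tree k)
mainTheorem5 k@(suc m) 4≤k logConcave = <⇒≱ (coefficientGap k 4≤k) (begin
  13 * (2 ^ k * 2 ^ k)             ≤⟨ indepCount-tree-2k+5 k ⟩
  s (2 * k + 5)                    ≡⟨ *-identityʳ _ ⟨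
  s (2 * k + 5) * 1                ≤⟨ *-monoʳ-≤ (s (2 * k + 5)) (indepCount-tree-2k+7 k) ⟩
  s (2 * k + 5) * s (2 * k + 7)    ≤⟨ logConcave-2k+6 ⟩
  s (2 * k + 6) * s (2 * k + 6)    ≤⟨ *-mono-≤ (indepCount-tree-2k+6 m) (indepCount-tree-2k+6 m) ⟩
  (17 + 2 * 2 ^ k + 2 * k) * (17 + 2 * 2 ^ k + 2 * k) ∎)
  where
  open ≤-Reasoning
  s = indepCount (tree k)
  e₆ : suc (2 * k + 5) ≡ 2 * k + 6
  e₆ = sym (+-suc (2 * k) 5)
  e₇ : suc (suc (2 * k + 5)) ≡ 2 * k + 7
  e₇ = trans (cong suc e₆) (sym (+-suc (2 * k) 6))
  2k+7≤α : suc (suc (2 * k + 5)) ≤ α (tree k)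
  2k+7≤α = subst (_≤ α (tree k)) (sym e₇) (≤-α (tree k) (2 * k + 7) (indepCount-tree-2k+7 k))
  logConcave-2k+6 : s (2 * k + 5) * s (2 * k + 7) ≤ s (2 * k + 6) * s (2 * k + 6)
  logConcave-2k+6 =
    subst₂ (λ i j → s (2 * k + 5) * s j ≤ s i * s i) e₆ e₇ (logConcave (2 * k + 5) (s≤s z≤n) 2k+7≤α)
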